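{- Let $T$ be the tree with vertices $v_1,\dots,v_{10}$ and edges $v_iv_{i+1}$ for $i=1,\dots,8$ together with the edge $v_3v_{10}$. Consider the token swapping instance on $T$ in which token $10$ is initially on $v_{10}$ and, for $i=1,\dots,9$, token $10-i$ is initially on $v_i$ (so tokens $9,8,\dots,1$ lie in this order along $v_1,\dots,v_9$). Then there is a sorting swap sequence of length $34$, whereas every sorting swap sequence in which token $10$ never leaves $v_{10}$ has length at least $36$. Consequently, although $v_{10}$ is initially a happy leaf, every optimal (minimum length) sorting swap sequence performs a swap on the edge $v_3v_{10}$, i.e. moves the token at the happy leaf $v_{10}$.
   Context: Token swapping: a graph has vertices $v_1,\dots,v_n$ and tokens labelled $1,\dots,n$, one on each vertex. A swap exchanges the tokens on the two endpoints of an edge. A swap sequence sorts the tokens if afterwards token $i$ is on $v_i$ for every $i$. A token is home if it is on its destination vertex; a leaf of a tree is a happy leaf if the token currently on it is home. -}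

module Defs where

open import Data.Nat using (ℕ; _≤_)
open import Data.Fin using (Fin; zero; suc; #_; _↑ˡ_; _≟_)
open import Data.List using (List; []; _∷_; take; length)
open import Data.Product using (_×_)
open import Relation.Nullary using (yes; no)
open import Relation.Binary.PropositionalEquality using (_≡_)

-- Vertices v₁,…,v₁₀ are represented by Fin 10: the vertex vᵢ is the element with toℕ = i - 1.
-- Tokens 1,…,10 are likewise represented by Fin 10: token t is the element with toℕ = t - 1.
-- So "token i is home" means: the token on vertex v is v itself.
Vertex : Set
Vertex = Fin 10

Token : Set
Token = Fin 10

-- The edges of the tree T: path edges vᵢvᵢ₊₁ (i = 1,…,8), indexed by Fin 8,
-- and the extra edge v₃v₁₀.
data Edge : Set where
  path   : Fin 8 → Edge
  branch : Edge

end₁ : Edge → Vertex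
end₁ (path i) = i ↑ˡ 2          -- vᵢ₊₁ in 0-based terms: index i
end₁ branch   = # 2

end₂ : Edge → Vertex
end₂ (path i) = suc (i ↑ˡ 1)
end₂ branch   = # 9

Config : Set
Config = Vertex → Token

swap : Edge → Config → Config
swap e c w with w ≟ end₁ e
... | yes _ = c (end₂ e)
... | no _ with w ≟ end₂ e
...   | yes _ = c (end₁ e)
...   | no _  = c w

apply : List Edge → Config → Config
apply []       c = c
apply (e ∷ es) c = apply es (swap e c)

Sorted : Config → Set
Sorted c = ∀ v → c v ≡ v

initial : Config
initial zero = # 8
initial (suc zero) = # 7
initial (suc (suc zero)) = # 6
initial (suc (suc (suc zero))) = # 5
initial (suc (suc (suc (suc zero)))) = # 4
initial (suc (suc (suc (suc (suc zero))))) = # 3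
initial (suc (suc (suc (suc (suc (suc zero)))))) = # 2
initial (suc (suc (suc (suc (suc (suc (suc zero))))))) = # 1
initial (suc (suc (suc (suc (suc (suc (suc (suc zero)))))))) = # 0
initial (suc (suc (suc (suc (suc (suc (suc (suc (suc zero))))))))) = # 9

Sorts : List Edge → Set
Sorts s = Sorted (apply s initial)

Token10Stays : List Edge → Set
Token10Stays s = ∀ k → k ≤ length s → apply (take k s) initial (# 9) ≡ # 9

Optimal : List Edge → Set
Optimal s = Sorts s × (∀ s′ → Sorts s′ → length s ≤ length s′)

module Submission where

-- Read the tokens on the path v₁,…,v₉ from left to right and
-- count inversions.  Initially tokens 9,…,1 appear in decreasing order, so
-- there are 36 inversions; in the sorted configuration there are none.
-- A swap on a path edge vᵢvᵢ₊₁ transposes two adjacent entries of this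
-- reading and therefore removes at most one inversion.  A swap on v₃v₁₀
-- after which token 10 is still on v₁₀ must exchange two equal tokens, so it
-- leaves the configuration unchanged.  Hence a sorting sequence that never
-- moves token 10 has length at least 36.  A sequence avoiding v₃v₁₀ never
-- moves token 10, and an explicit sequence of length 34 sorts the instance,
-- so an optimal sequence must use the edge v₃v₁₀.

open import Defs
open import Data.Nat using (ℕ; zero; suc; _+_; _≤_; z≤n; s≤s)
open import Data.Nat.Properties
  using (≤-trans; ≤-reflexive; m≤m+n; m≤n+m; n≤1+n; +-mono-≤; +-monoˡ-≤; +-comm; +-assoc; <⇒≱)
open import Data.Nat.Tactic.RingSolver using (solve-∀)
open import Data.Fin using (#_; toℕ; _<?_; _≟_)
import Data.Fin as Fin
open import Data.Fin.Properties using (all?)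
open import Data.Bool using (true; false; if_then_else_)
open import Data.List using (List; []; _∷_; length; take; map)
open import Data.List.Properties using (map-cong)
open import Data.List.Membership.Propositional using (_∈_)
open import Data.List.Relation.Unary.Any using (here; there; any?)
open import Data.Product using (_×_; Σ-syntax; _,_)
open import Function using (_∘_)
open import Data.Empty using (⊥-elim)
open import Relation.Binary using (Decidable)
open import Relation.Binary.PropositionalEquality
  using (_≡_; _≗_; refl; sym; trans; cong; subst)
open import Relation.Nullary using (¬_; Dec; does; yes; no)
open import Relation.Nullary.Decidable using (toWitness; decidable-stable)

-- Inversions of a list with respect to a decidable relation _≺_: the number
-- of pairs (x, y) with x before y and y ≺ x.  No order axioms are needed.
module Inversions {a r} {A : Set a} {_≺_ : A → A → Set r} (_≺?_ : Decidable _≺_) where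

  isBelow : A → A → ℕ
  isBelow y x = if does (y ≺? x) then 1 else 0

  isBelow≤1 : ∀ y x → isBelow y x ≤ 1
  isBelow≤1 y x with does (y ≺? x)
  ... | true  = s≤s z≤n
  ... | false = z≤n

  below : A → List A → ℕ
  below x []       = 0
  below x (y ∷ ys) = isBelow y x + below x ys

  inversions : List A → ℕ
  inversions []       = 0
  inversions (x ∷ xs) = below x xs + inversions xs

  -- Transposition of the entries at positions i and i + 1 (identity if
  -- there is no entry at position i + 1).
  swapAdj : ℕ → List A → List A
  swapAdj zero    []           = []
  swapAdj zero    (x ∷ [])     = x ∷ []
  swapAdj zero    (x ∷ y ∷ ys) = y ∷ x ∷ ys
  swapAdj (suc i) []           = []
  swapAdj (suc i) (x ∷ xs)     = x ∷ swapAdj i xs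

  below-swapAdj : ∀ x i ys → below x (swapAdj i ys) ≡ below x ys
  below-swapAdj x zero    []           = refl
  below-swapAdj x zero    (y ∷ [])     = refl
  below-swapAdj x zero    (y ∷ z ∷ ys) = exchange (isBelow z x) (isBelow y x) (below x ys)
    where
    exchange : ∀ p q r → p + (q + r) ≡ q + (p + r)
    exchange = solve-∀
  below-swapAdj x (suc i) []           = refl
  below-swapAdj x (suc i) (y ∷ ys)     = cong (isBelow y x +_) (below-swapAdj x i ys)

  -- Transposing the first two entries removes at most one inversion: only
  -- the pair formed by the two transposed entries changes status.
  inversions-swapHead : ∀ x y ys →
    inversions (x ∷ y ∷ ys) ≤ inversions (y ∷ x ∷ ys) + 1
  inversions-swapHead x y ys = begin
      (isBelow y x + X) + (Y + R)  ≤⟨ +-monoˡ-≤ _ (+-monoˡ-≤ X (isBelow≤1 y x)) ⟩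
      (1 + X) + (Y + R)            ≡⟨ rearrange X Y R ⟩
      (Y + (X + R)) + 1            ≤⟨ +-monoˡ-≤ 1 (+-monoˡ-≤ (X + R) (m≤n+m Y (isBelow x y))) ⟩
      ((isBelow x y + Y) + (X + R)) + 1 ∎
    where
    open Data.Nat.Properties.≤-Reasoning
    X Y R : ℕ
    X = below x ys
    Y = below y ys
    R = inversions ys
    rearrange : ∀ X Y R → (1 + X) + (Y + R) ≡ (Y + (X + R)) + 1
    rearrange = solve-∀

  inversions-swapAdj : ∀ i xs → inversions xs ≤ inversions (swapAdj i xs) + 1
  inversions-swapAdj zero    []           = m≤m+n 0 1
  inversions-swapAdj zero    (x ∷ [])     = m≤m+n 0 1
  inversions-swapAdj zero    (x ∷ y ∷ ys) = inversions-swapHead x y ys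
  inversions-swapAdj (suc i) []           = m≤m+n 0 1
  inversions-swapAdj (suc i) (x ∷ xs)     = begin
      below x xs + inversions xs      ≤⟨ +-mono-≤ (≤-reflexive (sym (below-swapAdj x i xs))) (inversions-swapAdj i xs) ⟩
      below x ys + (inversions ys + 1) ≡⟨ sym (+-assoc (below x ys) (inversions ys) 1) ⟩
      below x ys + inversions ys + 1   ∎
    where
    open Data.Nat.Properties.≤-Reasoning
    ys : List A
    ys = swapAdj i xs

open Inversions (_<?_ {10})

pathVertices : List Vertex
pathVertices = # 0 ∷ # 1 ∷ # 2 ∷ # 3 ∷ # 4 ∷ # 5 ∷ # 6 ∷ # 7 ∷ # 8 ∷ []

v₁₀ : Vertex
v₁₀ = # 9

token10 : Token
token10 = # 9

reading : Config → List Token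
reading c = map c pathVertices

potential : Config → ℕ
potential c = inversions (reading c)

reading-swap-path : ∀ i c → reading (swap (path i) c) ≡ swapAdj (toℕ i) (reading c)
reading-swap-path Fin.zero c = refl
reading-swap-path (Fin.suc Fin.zero) c = refl
reading-swap-path (Fin.suc (Fin.suc Fin.zero)) c = refl
reading-swap-path (Fin.suc (Fin.suc (Fin.suc Fin.zero))) c = refl
reading-swap-path (Fin.suc (Fin.suc (Fin.suc (Fin.suc Fin.zero)))) c = refl
reading-swap-path (Fin.suc (Fin.suc (Fin.suc (Fin.suc (Fin.suc Fin.zero))))) c = refl
reading-swap-path (Fin.suc (Fin.suc (Fin.suc (Fin.suc (Fin.suc (Fin.suc Fin.zero)))))) c = refl
reading-swap-path (Fin.suc (Fin.suc (Fin.suc (Fin.suc (Fin.suc (Fin.suc (Fin.suc Fin.zero))))))) c = refl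

swap-path-v₁₀ : ∀ i c → swap (path i) c v₁₀ ≡ c v₁₀
swap-path-v₁₀ Fin.zero c = refl
swap-path-v₁₀ (Fin.suc Fin.zero) c = refl
swap-path-v₁₀ (Fin.suc (Fin.suc Fin.zero)) c = refl
swap-path-v₁₀ (Fin.suc (Fin.suc (Fin.suc Fin.zero))) c = refl
swap-path-v₁₀ (Fin.suc (Fin.suc (Fin.suc (Fin.suc Fin.zero)))) c = refl
swap-path-v₁₀ (Fin.suc (Fin.suc (Fin.suc (Fin.suc (Fin.suc Fin.zero))))) c = refl
swap-path-v₁₀ (Fin.suc (Fin.suc (Fin.suc (Fin.suc (Fin.suc (Fin.suc Fin.zero)))))) c = refl
swap-path-v₁₀ (Fin.suc (Fin.suc (Fin.suc (Fin.suc (Fin.suc (Fin.suc (Fin.suc Fin.zero))))))) c = refl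

swap-equal-tokens : ∀ e c → c (end₁ e) ≡ c (end₂ e) → swap e c ≗ c
swap-equal-tokens e c same w with w ≟ end₁ e
... | yes refl = sym same
... | no _ with w ≟ end₂ e
...   | yes refl = same
...   | no _     = refl

-- One swap that keeps token 10 on v₁₀ lowers the potential by at most one.
-- For the edge v₃v₁₀ this forces the tokens on v₃ and v₁₀ to be equal.
potential-step : ∀ e c → c v₁₀ ≡ token10 → swap e c v₁₀ ≡ token10 →
                 potential c ≤ potential (swap e c) + 1
potential-step (path i) c _ _ =
  subst (λ xs → potential c ≤ inversions xs + 1)
        (sym (reading-swap-path i c)) (inversions-swapAdj (toℕ i) (reading c))
potential-step branch c before after =
  subst (λ xs → potential c ≤ inversions xs + 1)
        (sym (map-cong (swap-equal-tokens branch c (trans after (sym before))) pathVertices))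
        (m≤m+n (potential c) 1)

StaysFrom : Config → List Edge → Set
StaysFrom c s = ∀ k → k ≤ length s → apply (take k s) c v₁₀ ≡ token10

potential-bound : ∀ s c → StaysFrom c s → potential c ≤ potential (apply s c) + length s
potential-bound []       c stays = m≤m+n (potential c) 0
potential-bound (e ∷ es) c stays = begin
    potential c                ≤⟨ potential-step e c (stays 0 z≤n) (stays 1 (s≤s z≤n)) ⟩
    potential (swap e c) + 1   ≤⟨ +-monoˡ-≤ 1 (potential-bound es (swap e c) stays-after-e) ⟩
    P + length es + 1          ≡⟨ +-assoc P (length es) 1 ⟩
    P + (length es + 1)        ≡⟨ cong (P +_) (+-comm (length es) 1) ⟩
    P + suc (length es)        ∎
  where
  open Data.Nat.Properties.≤-Reasoning
  P : ℕ
  P = potential (apply es (swap e c))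
  stays-after-e : StaysFrom (swap e c) es
  stays-after-e k k≤ = stays (suc k) (s≤s k≤)

branch-free-stays : ∀ s c → ¬ (branch ∈ s) → c v₁₀ ≡ token10 → StaysFrom c s
branch-free-stays s              c _      home zero    _        = home
branch-free-stays []             c _      home (suc k) ()
branch-free-stays (branch ∷ es)  c free   home (suc k) _        = ⊥-elim (free (here refl))
branch-free-stays (path i ∷ es)  c free   home (suc k) (s≤s k≤) =
  branch-free-stays es (swap (path i) c) (free ∘ there) (trans (swap-path-v₁₀ i c) home) k k≤

potential-sorted : ∀ c → Sorted c → potential c ≡ 0
potential-sorted c sorted = cong inversions (map-cong sorted pathVertices)

-- Any sorting sequence that keeps token 10 at home has length at least 36,
-- the potential of the initial configuration (9,8,…,1 has 36 inversions,
-- which holds by computation).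
stay-lower-bound : ∀ s → Sorts s → Token10Stays s → 36 ≤ length s
stay-lower-bound s sorts stays =
  subst (36 ≤_) (cong (_+ length s) (potential-sorted (apply s initial) sorts))
        (potential-bound s initial stays)

solution : List Edge
solution =
  path (# 0) ∷ path (# 7) ∷ branch ∷ path (# 1) ∷ path (# 0) ∷ path (# 2) ∷
  path (# 1) ∷ path (# 3) ∷ path (# 2) ∷ path (# 4) ∷ path (# 3) ∷ path (# 5) ∷
  path (# 4) ∷ path (# 6) ∷ path (# 5) ∷ path (# 7) ∷ path (# 6) ∷ branch ∷
  path (# 2) ∷ path (# 1) ∷ path (# 3) ∷ path (# 2) ∷ path (# 4) ∷ path (# 3) ∷
  path (# 5) ∷ path (# 4) ∷ branch ∷ path (# 2) ∷ path (# 1) ∷ path (# 0) ∷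
  path (# 3) ∷ path (# 2) ∷ path (# 1) ∷ branch ∷ []

solution-sorts : Sorts solution
solution-sorts = toWitness {a? = all? (λ v → apply solution initial v ≟ v)} _

isBranch? : ∀ e → Dec (branch ≡ e)
isBranch? branch   = yes refl
isBranch? (path _) = no λ ()

mainTheorem1 : (Σ[ s ∈ List Edge ] (length s ≡ 34 × Sorts s))
               × (∀ s → Sorts s → Token10Stays s → 36 ≤ length s)
               × (∀ s → Optimal s → branch ∈ s)
mainTheorem1 = (solution , refl , solution-sorts) , stay-lower-bound , optimal-uses-branch
  where
  -- Without v₃v₁₀ the sequence would need 36 swaps, but 34 suffice.
  optimal-uses-branch : ∀ s → Optimal s → branch ∈ s
  optimal-uses-branch s (sorts , optimal) =
    decidable-stable (any? isBranch? s) λ free →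
      <⇒≱ (s≤s (n≤1+n 34))
          (≤-trans (stay-lower-bound s sorts (branch-free-stays s initial free refl))
                   (optimal solution solution-sorts))
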